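{- Let $\epsilon\in[0,1)$ and let $G=(V,E)$ be a finite simple graph with $\epsilon|E|$ an integer and $(1+\epsilon)\tfrac{|E|}{2}$ an integer. Then $\textsc{GEB}_\epsilon(G) = \textsc{GEB}_\epsilon(\mathcal{S}(G))$.
   Context: For a graph $H=(V_H,E_H)$, $\textsc{GEB}_\epsilon(H)$ is the minimum, over all partitions $E_H=E_1\cup E_2$ into disjoint sets with $|E_i|\le(1+\epsilon)\tfrac{|E_H|}{2}$, of the number of vertices incident to at least one edge of $E_1$ and at least one edge of $E_2$. The edge-split graph $\mathcal{S}(G)=(V',E')$ of $G=(V,E)$ has $V' = V\cup\{v_e : e\in E\}$ (one new vertex per edge) and $E' = \bigcup_{e=\{u,w\}\in E}\{\{u,v_e\},\{v_e,w\}\}$, i.e. each edge is replaced by a path of length two.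
   Formalization: The parameter ε ranges over the rational numbers in [0,1). -}

module Defs where

open import Data.Nat using (ℕ; _+_; _≤_)
open import Data.Bool using (Bool; true; false)
open import Data.Fin using (Fin; splitAt; _↑ˡ_; _↑ʳ_)
open import Data.Fin.Properties using (any?) renaming (_≟_ to _≟ᶠ_)
open import Data.List using (List; length; filter)
open import Data.List using () renaming (allFin to allFinL)
open import Data.Product using (_×_; _,_; proj₁; proj₂; ∃-syntax; Σ-syntax)
open import Data.Product.Properties using ()
open import Data.Sum using (_⊎_; inj₁; inj₂; [_,_])
open import Data.Integer using (ℤ; +_)
open import Data.Rational using (ℚ; _/_; _*_; 1ℚ; ½) renaming (_≤_ to _≤ℚ_; _+_ to _+ℚ_)
open import Relation.Binary.PropositionalEquality using (_≡_; _≢_)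
open import Relation.Nullary using (¬_; Dec; yes; no)
open import Relation.Nullary.Decidable using (_×-dec_; _⊎-dec_)
open import Data.Bool.Properties using () renaming (_≟_ to _≟ᵇ_)

-- A finite (multi)graph: vertex set Fin n, edge set Fin m (edges are indexed),
-- each edge having an (ordered representation of its) pair of endpoints.
record Graph : Set where
  constructor mkGraph
  field
    n    : ℕ
    m    : ℕ
    ends : Fin m → Fin n × Fin n

open Graph public

IsSimple : Graph → Set
IsSimple G =
  (∀ e → proj₁ (ends G e) ≢ proj₂ (ends G e)) ×
  (∀ e f → (ends G e ≡ ends G f ⊎ (proj₁ (ends G e) ≡ proj₂ (ends G f) × proj₂ (ends G e) ≡ proj₁ (ends G f))) → e ≡ f)

Incident : (G : Graph) → Fin (n G) → Fin (m G) → Set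
Incident G v e = (v ≡ proj₁ (ends G e)) ⊎ (v ≡ proj₂ (ends G e))

-- A partition E = E₁ ∪ E₂ is a 2-colouring of the edges: E₁ = c⁻¹(true), E₂ = c⁻¹(false).
Partition : Graph → Set
Partition G = Fin (m G) → Bool

TouchesColour : (G : Graph) → Partition G → Bool → Fin (n G) → Set
TouchesColour G c b v = ∃[ e ] (c e ≡ b × Incident G v e)

touches? : (G : Graph) (c : Partition G) (b : Bool) (v : Fin (n G)) → Dec (TouchesColour G c b v)
touches? G c b v = any? (λ e → (c e ≟ᵇ b) ×-dec ((v ≟ᶠ proj₁ (ends G e)) ⊎-dec (v ≟ᶠ proj₂ (ends G e))))

size : (G : Graph) → Partition G → Bool → ℕ
size G c b = length (filter (λ e → c e ≟ᵇ b) (allFinL (m G)))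

cost : (G : Graph) → Partition G → ℕ
cost G c = length (filter (λ v → touches? G c true v ×-dec touches? G c false v) (allFinL (n G)))

ℕ→ℚ : ℕ → ℚ
ℕ→ℚ k = (+ k) / 1

Balanced : ℚ → (G : Graph) → Partition G → Set
Balanced ε G c = (ℕ→ℚ (size G c true) ≤ℚ ((1ℚ +ℚ ε) * ℕ→ℚ (m G)) * ½) ×
                 (ℕ→ℚ (size G c false) ≤ℚ ((1ℚ +ℚ ε) * ℕ→ℚ (m G)) * ½)

IsGEB : ℚ → Graph → ℕ → Set
IsGEB ε G k = (Σ[ c ∈ Partition G ] (Balanced ε G c × cost G c ≡ k)) ×
              (∀ c → Balanced ε G c → k ≤ cost G c)

IsInteger : ℚ → Set
IsInteger q = ∃[ z ] q ≡ z / 1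

-- Edge-split graph S(G): vertices V ⊎ E encoded as Fin (n + m)
-- (original vertex v ↦ v ↑ˡ m, subdivision vertex v_e ↦ n ↑ʳ e);
-- edges Fin (m + m): (e ↑ˡ m) is {u, v_e}, (m ↑ʳ e) is {v_e, w} where ends e = (u , w).
split : Graph → Graph
split (mkGraph n m ends) = mkGraph (n + m) (m + m)
  (λ x → [ (λ e → (proj₁ (ends e) ↑ˡ m) , (n ↑ʳ e))
         , (λ e → (n ↑ʳ e) , (proj₂ (ends e) ↑ˡ m)) ] (splitAt m x))

-- Colouring both halves of every edge like the edge itself turns a partition of G into one of S(G)
-- with twice the part sizes and no new boundary vertices: subdivision vertices stay monochromatic and
-- an original vertex sees the same colours as in G. Conversely, from a balanced partition of S(G) let
-- every edge whose halves agree keep their colour and share the mixed edges out between the parts; as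
-- the bound (1+ε)|E|/2 is an integer b and S(G) has bound 2b, this can be done keeping both parts of
-- size at most b. A vertex of G that is a boundary vertex without being one in S(G) is charged to a
-- mixed edge at it, at most one vertex per edge, and the subdivision vertex of every mixed edge is a
-- boundary vertex of S(G). So a balanced partition of either graph is matched by one of the other that
-- is no more expensive, and the two minima coincide.

module Submission where

open import Defs
open import Data.Bool using (Bool; true; false; T; not; _∧_; _xor_; if_then_else_)
open import Data.Bool.Properties using (T-∧) renaming (_≟_ to _≟ᵇ_)
open import Data.Empty using (⊥; ⊥-elim)
open import Data.Fin using (Fin; zero; suc; _↑ˡ_; _↑ʳ_; splitAt)
open import Data.Fin.Properties using (splitAt-↑ˡ; splitAt-↑ʳ; ↑ˡ-injective; ↑ʳ-injective; suc-injective; any?)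
  renaming (_≟_ to _≟ᶠ_)
open import Data.Product using (_×_; _,_; proj₁; proj₂; ∃-syntax; Σ-syntax)
open import Data.Sum using (_⊎_; inj₁; inj₂; reduce)
open import Data.Unit using (tt)
open import Function using (_∘_)
open import Function.Bundles using (_⇔_; mk⇔; Equivalence)
open import Relation.Binary.PropositionalEquality
  using (_≡_; _≢_; refl; sym; trans; cong; cong₂; subst; subst₂; module ≡-Reasoning)
open import Relation.Nullary using (¬_; Dec; does; yes; no; contradiction)
open import Relation.Nullary.Decidable using (T?; _×-dec_)

module Counting where

  open import Data.Nat using (ℕ; zero; suc; _+_; _≤_; z≤n; s≤s)
  open import Data.Nat.Properties
    using (+-0-commutativeMonoid; +-mono-≤; +-assoc; ≤-refl; ≤-reflexive; ≤-trans; m≤m+n; m≤n+m; ≤-pred; module ≤-Reasoning)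
  open import Algebra.Properties.CommutativeMonoid.Sum +-0-commutativeMonoid
    using (sum; sum-cong-≗; ∑-distrib-+; ∑-comm; sum-replicate-zero)
  open import Data.Vec.Functional using (_∷_)
  open import Data.List using (length; filter; tabulate) renaming (allFin to allFinL)
  open import Relation.Unary using (Pred; Decidable)

  T-does⁺ : ∀ {a} {A : Set a} (a? : Dec A) → A → T (does a?)
  T-does⁺ (yes _) _ = tt
  T-does⁺ (no ¬a) a = ¬a a

  T-does⁻ : ∀ {a} {A : Set a} (a? : Dec A) → T (does a?) → A
  T-does⁻ (yes a) _ = a

  indicator : Bool → ℕ
  indicator false = 0
  indicator true  = 1

  count : ∀ {n} → (Fin n → Bool) → ℕ
  count p = sum (indicator ∘ p)

  sum-mono-≤ : ∀ {n} {f g : Fin n → ℕ} → (∀ i → f i ≤ g i) → sum f ≤ sum g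
  sum-mono-≤ {zero}  _   = z≤n
  sum-mono-≤ {suc n} f≤g = +-mono-≤ (f≤g zero) (sum-mono-≤ (f≤g ∘ suc))

  sum-↑ : ∀ a {b} (f : Fin (a + b) → ℕ) → sum f ≡ sum (f ∘ (_↑ˡ b)) + sum (f ∘ (a ↑ʳ_))
  sum-↑ zero    f = refl
  sum-↑ (suc a) f = trans (cong (f zero +_) (sum-↑ a (f ∘ suc))) (sym (+-assoc (f zero) _ _))

  length-filter-tabulate : ∀ {a p n} {A : Set a} {P : Pred A p} (P? : Decidable P) (f : Fin n → A) →
    length (filter P? (tabulate f)) ≡ count (does ∘ P? ∘ f)
  length-filter-tabulate {n = zero}  P? f = refl
  length-filter-tabulate {n = suc n} P? f with does (P? (f zero))
  ... | true  = cong suc (length-filter-tabulate P? (f ∘ suc))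
  ... | false = length-filter-tabulate P? (f ∘ suc)

  length-filter-allFin : ∀ {p n} {P : Pred (Fin n) p} (P? : Decidable P) →
    length (filter P? (allFinL n)) ≡ count (does ∘ P?)
  length-filter-allFin P? = length-filter-tabulate P? (λ i → i)

  indicator-mono : ∀ {a b} → (T a → T b) → indicator a ≤ indicator b
  indicator-mono {false}         _ = z≤n
  indicator-mono {true} {true}   _ = ≤-refl
  indicator-mono {true} {false} a⇒b = ⊥-elim (a⇒b tt)

  indicator-≤-+ : ∀ {a b c} → (T a → T b ⊎ T c) → indicator a ≤ indicator b + indicator c
  indicator-≤-+ {false}                 _ = z≤n
  indicator-≤-+ {true} {true}           _ = s≤s z≤n
  indicator-≤-+ {true} {false} {true}   _ = s≤s z≤n
  indicator-≤-+ {true} {false} {false} a⇒b∨c with a⇒b∨c tt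
  ... | inj₁ ()
  ... | inj₂ ()

  count-mono : ∀ {n} {p q : Fin n → Bool} → (∀ i → T (p i) → T (q i)) → count p ≤ count q
  count-mono p⇒q = sum-mono-≤ (λ i → indicator-mono (p⇒q i))

  count-≤-+ : ∀ {n} {p q r : Fin n → Bool} → (∀ i → T (p i) → T (q i) ⊎ T (r i)) → count p ≤ count q + count r
  count-≤-+ {p = p} {q} {r} p⇒q∨r = begin
    count p                                       ≤⟨ sum-mono-≤ (λ i → indicator-≤-+ (p⇒q∨r i)) ⟩
    sum (λ i → indicator (q i) + indicator (r i)) ≡⟨ ∑-distrib-+ (indicator ∘ q) (indicator ∘ r) ⟩
    count q + count r                             ∎
    where open ≤-Reasoning

  count-false : ∀ n → count {n} (λ _ → false) ≡ 0
  count-false = sum-replicate-zero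

  count-↑ : ∀ a {b} (p : Fin (a + b) → Bool) → count p ≡ count (p ∘ (_↑ˡ b)) + count (p ∘ (a ↑ʳ_))
  count-↑ a p = sum-↑ a (indicator ∘ p)

  count-witness : ∀ {n} (p : Fin n → Bool) i → T (p i) → 1 ≤ count p
  count-witness p zero    pi = ≤-trans (indicator-mono {true} (λ _ → pi)) (m≤m+n _ _)
  count-witness p (suc i) pi = ≤-trans (count-witness (p ∘ suc) i pi) (m≤n+m _ _)

  count-singleton : ∀ {n} (i : Fin n) → count (λ j → does (i ≟ᶠ j)) ≡ 1
  count-singleton {suc n} zero    = cong suc (count-false n)
  count-singleton {suc n} (suc i) = count-singleton i

  image : ∀ {m n} → (Fin m → Fin n) → (Fin m → Bool) → Fin n → Bool
  image f p v = does (any? (λ e → T? (p e) ×-dec (f e ≟ᶠ v)))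

  count-image : ∀ {m n} (f : Fin m → Fin n) (p : Fin m → Bool) → count (image f p) ≤ count p
  count-image {m} {n} f p = begin
    count (image f p)                  ≤⟨ sum-mono-≤ hit ⟩
    sum (λ v → count (λ e → sends e v)) ≡⟨ ∑-comm (λ v e → indicator (sends e v)) ⟩
    sum (λ e → count (sends e))         ≤⟨ sum-mono-≤ fibre ⟩
    count p                            ∎
    where
    open ≤-Reasoning
    sends : Fin m → Fin n → Bool
    sends e v = p e ∧ does (f e ≟ᶠ v)
    hit : ∀ v → indicator (image f p v) ≤ count (λ e → sends e v)
    hit v with any? (λ e → T? (p e) ×-dec (f e ≟ᶠ v))
    ... | no _                 = z≤n
    ... | yes (e , pe , refl) = count-witness (λ e → sends e v) e (Equivalence.from T-∧ (pe , T-does⁺ (f e ≟ᶠ f e) refl))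
    fibre : ∀ e → count (sends e) ≤ indicator (p e)
    fibre e with p e
    ... | true  = ≤-reflexive (count-singleton (f e))
    ... | false = ≤-reflexive (count-false n)

  count-choose : ∀ {n} (p : Fin n → Bool) y → y ≤ count p →
    Σ[ g ∈ (Fin n → Bool) ] count (λ i → p i ∧ g i) ≡ y
  count-choose {zero}  p .0 z≤n = (λ ()) , refl
  count-choose {suc n} p y y≤ with p zero
  count-choose {suc n} p y y≤ | false with count-choose (p ∘ suc) y y≤
  ... | g , cg = (false ∷ g) , cg
  count-choose {suc n} p zero y≤ | true with count-choose (p ∘ suc) zero z≤n
  ... | g , cg = (false ∷ g) , cg
  count-choose {suc n} p (suc y) y≤ | true with count-choose (p ∘ suc) y (≤-pred y≤)
  ... | g , cg = (true ∷ g) , cong suc cg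

  count-cong : ∀ {n} {p q : Fin n → Bool} → (∀ i → p i ≡ q i) → count p ≡ count q
  count-cong p≗q = sum-cong-≗ (cong indicator ∘ p≗q)

  count-split : ∀ {n} {p q r : Fin n → Bool} → (∀ i → indicator (p i) ≡ indicator (q i) + indicator (r i)) →
    count p ≡ count q + count r
  count-split {q = q} {r} p≗q+r = trans (sum-cong-≗ p≗q+r) (∑-distrib-+ (indicator ∘ q) (indicator ∘ r))

  count-+-split-twice : ∀ {n} {p q r s : Fin n → Bool} →
    (∀ i → indicator (p i) + indicator (q i) ≡ indicator (r i) + indicator (r i) + indicator (s i)) →
    count p + count q ≡ count r + count r + count s
  count-+-split-twice {p = p} {q} {r} {s} pointwise = begin
    count p + count q                                               ≡⟨ ∑-distrib-+ (indicator ∘ p) (indicator ∘ q) ⟨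
    sum (λ i → indicator (p i) + indicator (q i))                   ≡⟨ sum-cong-≗ pointwise ⟩
    sum (λ i → indicator (r i) + indicator (r i) + indicator (s i)) ≡⟨ ∑-distrib-+ (λ i → indicator (r i) + indicator (r i)) (indicator ∘ s) ⟩
    sum (λ i → indicator (r i) + indicator (r i)) + count s         ≡⟨ cong (_+ count s) (∑-distrib-+ (indicator ∘ r) (indicator ∘ r)) ⟩
    count r + count r + count s                                     ∎
    where open ≡-Reasoning

  count-∧-not : ∀ {n} (p g : Fin n → Bool) → count p ≡ count (λ i → p i ∧ g i) + count (λ i → p i ∧ not (g i))
  count-∧-not p g = count-split pointwise
    where
    pointwise : ∀ i → indicator (p i) ≡ indicator (p i ∧ g i) + indicator (p i ∧ not (g i))
    pointwise i with p i | g i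
    ... | true  | true  = refl
    ... | true  | false = refl
    ... | false | _     = refl

module Budget where

  open import Data.Nat using (ℕ; _+_; _≤_; _≤?_)
  open import Data.Nat.Properties
    using (≮⇒≥; <⇒≱; ≰⇒>; +-mono-<; +-mono-≤; +-monoʳ-≤; +-cancelˡ-≤; <⇒≤; m≤m+n; +-identityʳ; ≤-trans; ≤-reflexive;
           m≤n⇒∃[o]m+o≡n; module ≤-Reasoning)
  open import Data.Nat.Solver using (module +-*-Solver)
  open +-*-Solver using (solve; _:+_; _:=_)

  half-≤ : ∀ {a b} → a + a ≤ b + b → a ≤ b
  half-≤ a+a≤b+b = ≮⇒≥ (λ b<a → <⇒≱ (+-mono-< b<a b<a) a+a≤b+b)

  -- Read t, f, x as the numbers of edges of G whose two halves lie both in the first part, both in the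
  -- second, or in different parts; the x mixed edges can be shared out as y + z keeping both parts within b.
  split-budget : ∀ t f x b → t + t + x ≤ b + b → f + f + x ≤ b + b →
    ∃[ y ] ∃[ z ] (y + z ≡ x × t + y ≤ b × f + z ≤ b)
  split-budget t f x b t-fits f-fits with m≤n⇒∃[o]m+o≡n (half-≤ (≤-trans (m≤m+n (t + t) x) t-fits))
  ... | k , t+k≡b with x ≤? k
  ...   | yes x≤k = x , 0 , +-identityʳ x , t+x≤b , f+0≤b
    where
    open ≤-Reasoning
    t+x≤b : t + x ≤ b
    t+x≤b = begin t + x ≤⟨ +-monoʳ-≤ t x≤k ⟩ t + k ≡⟨ t+k≡b ⟩ b ∎
    f+0≤b : f + 0 ≤ b
    f+0≤b = begin f + 0 ≡⟨ +-identityʳ f ⟩ f ≤⟨ half-≤ (≤-trans (m≤m+n (f + f) x) f-fits) ⟩ b ∎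
  ...   | no x≰k with m≤n⇒∃[o]m+o≡n (<⇒≤ (≰⇒> x≰k))
  ...     | z , k+z≡x = k , z , k+z≡x , ≤-reflexive t+k≡b , +-cancelˡ-≤ (t + k) (f + z) b shifted
    where
    open ≤-Reasoning
    total : t + f + x ≤ b + b
    total = half-≤ (begin
      (t + f + x) + (t + f + x) ≡⟨ solve 3 (λ t f x → (t :+ f :+ x) :+ (t :+ f :+ x) := (t :+ t :+ x) :+ (f :+ f :+ x)) refl t f x ⟩
      (t + t + x) + (f + f + x) ≤⟨ +-mono-≤ t-fits f-fits ⟩
      (b + b) + (b + b)         ∎)
    shifted : (t + k) + (f + z) ≤ (t + k) + b
    shifted = begin
      (t + k) + (f + z) ≡⟨ solve 4 (λ t k f z → (t :+ k) :+ (f :+ z) := t :+ f :+ (k :+ z)) refl t k f z ⟩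
      t + f + (k + z)   ≡⟨ cong (t + f +_) k+z≡x ⟩
      t + f + x         ≤⟨ total ⟩
      b + b             ≡⟨ cong (_+ b) (sym t+k≡b) ⟩
      (t + k) + b       ∎

module Partitions where

  open Counting
  open import Data.Nat using (ℕ; _≤_)
  open import Data.Nat.Properties using (≤-antisym; ≤-trans; ≤-reflexive)
  open import Data.Rational using (ℚ)

  -- Balanced, once the bound (1+ε)|E|/2 is known to be the natural number b.
  Within : ℕ → (G : Graph) → Partition G → Set
  Within b G c = size G c true ≤ b × size G c false ≤ b

  bichromatic : (G : Graph) → Partition G → Fin (n G) → Bool
  bichromatic G c v = does (touches? G c true v ×-dec touches? G c false v)

  module _ (G : Graph) (c : Partition G) where

    size-count : ∀ b → size G c b ≡ count (λ e → does (c e ≟ᵇ b))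
    size-count b = length-filter-allFin (λ e → c e ≟ᵇ b)

    size-true : size G c true ≡ count c
    size-true = trans (size-count true) (count-cong is-true)
      where
      is-true : ∀ e → does (c e ≟ᵇ true) ≡ c e
      is-true e with c e
      ... | true  = refl
      ... | false = refl

    size-false : size G c false ≡ count (not ∘ c)
    size-false = trans (size-count false) (count-cong is-false)
      where
      is-false : ∀ e → does (c e ≟ᵇ false) ≡ not (c e)
      is-false e with c e
      ... | true  = refl
      ... | false = refl

    cost-count : cost G c ≡ count (bichromatic G c)
    cost-count = length-filter-allFin (λ v → touches? G c true v ×-dec touches? G c false v)

    bichromatic⁺ : ∀ {v} → TouchesColour G c true v → TouchesColour G c false v → T (bichromatic G c v)
    bichromatic⁺ t f = T-does⁺ (touches? G c true _ ×-dec touches? G c false _) (t , f)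

    bichromatic⁻ : ∀ {v} → T (bichromatic G c v) → TouchesColour G c true v × TouchesColour G c false v
    bichromatic⁻ = T-does⁻ (touches? G c true _ ×-dec touches? G c false _)

  DominatedBy : ℚ → Graph → Graph → Set
  DominatedBy ε G H = ∀ c → Balanced ε G c → Σ[ c′ ∈ Partition H ] (Balanced ε H c′ × cost H c′ ≤ cost G c)

  IsGEB-transfer : ∀ {ε G H k} → DominatedBy ε G H → DominatedBy ε H G → IsGEB ε G k → IsGEB ε H k
  -- `let` rather than `with`: abstracting over `Balanced` makes Agda normalise rationals, which is very slow.
  IsGEB-transfer {ε} {G} {H} {k} G≼H H≼G ((c , balanced , cost≡k) , minimal) =
    let c′ , balanced′ , c′≤c = G≼H c balanced
    in (c′ , balanced′ , ≤-antisym (≤-trans c′≤c (≤-reflexive cost≡k)) (minimal′ c′ balanced′)) , minimal′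
    where
    minimal′ : ∀ c′ → Balanced ε H c′ → k ≤ cost H c′
    minimal′ c′ balanced′ = let d , balanced-d , d≤c′ = H≼G c′ balanced′ in ≤-trans (minimal d balanced-d) d≤c′

module HalfColours where

  open Counting using (indicator)
  open import Data.Nat using (_+_)

  resolve : Bool → Bool → Bool → Bool
  resolve l r g = if l xor r then g else l

  indicator-halves : ∀ l r → indicator l + indicator r ≡ indicator (l ∧ r) + indicator (l ∧ r) + indicator (l xor r)
  indicator-halves true  true  = refl
  indicator-halves true  false = refl
  indicator-halves false true  = refl
  indicator-halves false false = refl

  indicator-not-halves : ∀ l r →
    indicator (not l) + indicator (not r) ≡ indicator (not l ∧ not r) + indicator (not l ∧ not r) + indicator (l xor r)
  indicator-not-halves true  true  = refl
  indicator-not-halves true  false = refl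
  indicator-not-halves false true  = refl
  indicator-not-halves false false = refl

  indicator-resolve : ∀ l r g → indicator (resolve l r g) ≡ indicator (l ∧ r) + indicator ((l xor r) ∧ g)
  indicator-resolve true  true  g = refl
  indicator-resolve true  false g = refl
  indicator-resolve false true  g = refl
  indicator-resolve false false g = refl

  indicator-not-resolve : ∀ l r g →
    indicator (not (resolve l r g)) ≡ indicator (not l ∧ not r) + indicator ((l xor r) ∧ not g)
  indicator-not-resolve true  true  g = refl
  indicator-not-resolve true  false g = refl
  indicator-not-resolve false true  g = refl
  indicator-not-resolve false false g = refl

  resolve-endpoint : ∀ {A : Set} l r g {b} {u w v : A} → resolve l r g ≡ b → v ≡ u ⊎ v ≡ w →
    (l ≡ b × v ≡ u) ⊎ (r ≡ b × v ≡ w) ⊎ (T (l xor r) × (if l xor g then u else w) ≡ v)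
  resolve-endpoint true  true  g     refl (inj₁ v≡u) = inj₁ (refl , v≡u)
  resolve-endpoint true  true  g     refl (inj₂ v≡w) = inj₂ (inj₁ (refl , v≡w))
  resolve-endpoint false false g     refl (inj₁ v≡u) = inj₁ (refl , v≡u)
  resolve-endpoint false false g     refl (inj₂ v≡w) = inj₂ (inj₁ (refl , v≡w))
  resolve-endpoint true  false true  refl (inj₁ v≡u) = inj₁ (refl , v≡u)
  resolve-endpoint true  false true  refl (inj₂ v≡w) = inj₂ (inj₂ (tt , sym v≡w))
  resolve-endpoint true  false false refl (inj₁ v≡u) = inj₂ (inj₂ (tt , sym v≡u))
  resolve-endpoint true  false false refl (inj₂ v≡w) = inj₂ (inj₁ (refl , v≡w))
  resolve-endpoint false true  true  refl (inj₁ v≡u) = inj₂ (inj₂ (tt , sym v≡u))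
  resolve-endpoint false true  true  refl (inj₂ v≡w) = inj₂ (inj₁ (refl , v≡w))
  resolve-endpoint false true  false refl (inj₁ v≡u) = inj₁ (refl , v≡u)
  resolve-endpoint false true  false refl (inj₂ v≡w) = inj₂ (inj₂ (tt , sym v≡w))

↑ˡ≢↑ʳ : ∀ {a b} (i : Fin a) (j : Fin b) → i ↑ˡ b ≢ a ↑ʳ j
↑ˡ≢↑ʳ zero    j ()
↑ˡ≢↑ʳ (suc i) j eq = ↑ˡ≢↑ʳ i j (suc-injective eq)

module Subdivision (G : Graph) where

  open Counting
  open Budget
  open Partitions
  open HalfColours
  open import Data.Nat using (_+_; _≤_)
  open import Data.Nat.Properties using (m≤m+n; +-monoʳ-≤; +-cancelˡ-≡; +-identityʳ; +-mono-≤; ≤-trans; module ≤-Reasoning)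

  end₁ end₂ : Fin (m G) → Fin (n G)
  end₁ = proj₁ ∘ ends G
  end₂ = proj₂ ∘ ends G

  orig : Fin (n G) → Fin (n (split G))
  orig v = v ↑ˡ m G

  mid : Fin (m G) → Fin (n (split G))
  mid e = n G ↑ʳ e

  left right : Fin (m G) → Fin (m (split G))
  left e = e ↑ˡ m G
  right e = m G ↑ʳ e

  parent : Fin (m (split G)) → Fin (m G)
  parent x = reduce (splitAt (m G) x)

  incident-left-end₁ : ∀ e → Incident (split G) (orig (end₁ e)) (left e)
  incident-left-end₁ e rewrite splitAt-↑ˡ (m G) e (m G) = inj₁ refl

  incident-left-mid : ∀ e → Incident (split G) (mid e) (left e)
  incident-left-mid e rewrite splitAt-↑ˡ (m G) e (m G) = inj₂ refl

  incident-right-mid : ∀ e → Incident (split G) (mid e) (right e)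
  incident-right-mid e rewrite splitAt-↑ʳ (m G) (m G) e = inj₁ refl

  incident-right-end₂ : ∀ e → Incident (split G) (orig (end₂ e)) (right e)
  incident-right-end₂ e rewrite splitAt-↑ʳ (m G) (m G) e = inj₂ refl

  incident-orig-parent : ∀ {v} x → Incident (split G) (orig v) x → Incident G v (parent x)
  incident-orig-parent x with splitAt (m G) x
  ... | inj₁ e = λ { (inj₁ v≡u) → inj₁ (↑ˡ-injective (m G) _ _ v≡u) ; (inj₂ v≡mid) → ⊥-elim (↑ˡ≢↑ʳ _ e v≡mid) }
  ... | inj₂ e = λ { (inj₁ v≡mid) → ⊥-elim (↑ˡ≢↑ʳ _ e v≡mid) ; (inj₂ v≡w) → inj₂ (↑ˡ-injective (m G) _ _ v≡w) }

  incident-mid-parent : ∀ {e} x → Incident (split G) (mid e) x → parent x ≡ e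
  incident-mid-parent x with splitAt (m G) x
  ... | inj₁ e′ = λ { (inj₁ mid≡u) → ⊥-elim (↑ˡ≢↑ʳ _ _ (sym mid≡u)) ; (inj₂ mid≡mid) → sym (↑ʳ-injective (n G) _ _ mid≡mid) }
  ... | inj₂ e′ = λ { (inj₁ mid≡mid) → sym (↑ʳ-injective (n G) _ _ mid≡mid) ; (inj₂ mid≡w) → ⊥-elim (↑ˡ≢↑ʳ _ _ (sym mid≡w)) }

  parent-left : ∀ e → parent (left e) ≡ e
  parent-left e = cong reduce (splitAt-↑ˡ (m G) e (m G))

  parent-right : ∀ e → parent (right e) ≡ e
  parent-right e = cong reduce (splitAt-↑ʳ (m G) (m G) e)

  count-edges : (p : Fin (m (split G)) → Bool) → count p ≡ count (p ∘ left) + count (p ∘ right)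
  count-edges = count-↑ (m G)

  count-vertices : (p : Fin (n (split G)) → Bool) → count p ≡ count (p ∘ orig) + count (p ∘ mid)
  count-vertices = count-↑ (n G)

  module Lift (c : Partition G) where

    lifted : Partition (split G)
    lifted = c ∘ parent

    size-lifted : ∀ b → size (split G) lifted b ≡ size G c b + size G c b
    size-lifted b = begin
      size (split G) lifted b                              ≡⟨ size-count (split G) lifted b ⟩
      count (is-b ∘ lifted)                                ≡⟨ count-edges (is-b ∘ lifted) ⟩
      count (is-b ∘ lifted ∘ left) + count (is-b ∘ lifted ∘ right)
        ≡⟨ cong₂ _+_ (count-cong (cong (is-b ∘ c) ∘ parent-left)) (count-cong (cong (is-b ∘ c) ∘ parent-right)) ⟩
      count (is-b ∘ c) + count (is-b ∘ c)                 ≡⟨ cong₂ _+_ (sym (size-count G c b)) (sym (size-count G c b)) ⟩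
      size G c b + size G c b                              ∎
      where
      open ≡-Reasoning
      is-b : Bool → Bool
      is-b x = does (x ≟ᵇ b)

    within-lifted : ∀ {b} → Within b G c → Within (b + b) (split G) lifted
    within-lifted (true≤b , false≤b) =
      subst (_≤ _) (sym (size-lifted true)) (+-mono-≤ true≤b true≤b) ,
      subst (_≤ _) (sym (size-lifted false)) (+-mono-≤ false≤b false≤b)

    touches-lifted-orig : ∀ {b v} → TouchesColour (split G) lifted b (orig v) → TouchesColour G c b v
    touches-lifted-orig (x , cx≡b , incident) = parent x , cx≡b , incident-orig-parent x incident

    mid-monochromatic : ∀ e → T (bichromatic (split G) lifted (mid e)) → ⊥
    mid-monochromatic e bichr with bichromatic⁻ (split G) lifted bichr
    ... | (x , cx≡true , incident-x) , (y , cy≡false , incident-y) with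
          trans (incident-mid-parent x incident-x) (sym (incident-mid-parent y incident-y))
    ... | px≡py with trans (sym cx≡true) (trans (cong c px≡py) cy≡false)
    ... | ()

    cost-lifted : cost (split G) lifted ≤ cost G c
    cost-lifted = begin
      cost (split G) lifted                     ≡⟨ cost-count (split G) lifted ⟩
      count (bichromatic (split G) lifted)      ≡⟨ count-vertices (bichromatic (split G) lifted) ⟩
      count (bichromatic (split G) lifted ∘ orig) + count (bichromatic (split G) lifted ∘ mid)
        ≤⟨ +-mono-≤ (count-mono orig-bichromatic) (count-mono {q = λ _ → false} mid-monochromatic) ⟩
      count (bichromatic G c) + count {m G} (λ _ → false) ≡⟨ cong₂ _+_ (sym (cost-count G c)) (count-false (m G)) ⟩
      cost G c + 0                              ≡⟨ +-identityʳ (cost G c) ⟩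
      cost G c                                  ∎
      where
      open ≤-Reasoning
      orig-bichromatic : ∀ v → T (bichromatic (split G) lifted (orig v)) → T (bichromatic G c v)
      orig-bichromatic v bichr with bichromatic⁻ (split G) lifted bichr
      ... | t , f = bichromatic⁺ G c (touches-lifted-orig t) (touches-lifted-orig f)

  module Projection (c′ : Partition (split G)) where

    L R mixed both neither : Fin (m G) → Bool
    L = c′ ∘ left
    R = c′ ∘ right
    mixed e = L e xor R e
    both e = L e ∧ R e
    neither e = not (L e) ∧ not (R e)

    projected : (Fin (m G) → Bool) → Partition G
    projected g e = resolve (L e) (R e) (g e)

    -- For a mixed edge, the endpoint whose half does not get the edge's new colour: the only vertex at
    -- which the edge can make a boundary vertex of G that is not one of S(G).
    blame : (Fin (m G) → Bool) → Fin (m G) → Fin (n G)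
    blame g e = if L e xor g e then end₁ e else end₂ e

    size-split-true : size (split G) c′ true ≡ count both + count both + count mixed
    size-split-true = begin
      size (split G) c′ true   ≡⟨ size-true (split G) c′ ⟩
      count c′                 ≡⟨ count-edges c′ ⟩
      count L + count R        ≡⟨ count-+-split-twice (λ e → indicator-halves (L e) (R e)) ⟩
      count both + count both + count mixed ∎
      where open ≡-Reasoning

    size-split-false : size (split G) c′ false ≡ count neither + count neither + count mixed
    size-split-false = begin
      size (split G) c′ false              ≡⟨ size-false (split G) c′ ⟩
      count (not ∘ c′)                     ≡⟨ count-edges (not ∘ c′) ⟩
      count (not ∘ L) + count (not ∘ R)    ≡⟨ count-+-split-twice (λ e → indicator-not-halves (L e) (R e)) ⟩
      count neither + count neither + count mixed ∎
      where open ≡-Reasoning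

    size-projected-true : ∀ g → size G (projected g) true ≡ count both + count (λ e → mixed e ∧ g e)
    size-projected-true g = trans (size-true G (projected g)) (count-split (λ e → indicator-resolve (L e) (R e) (g e)))

    size-projected-false : ∀ g → size G (projected g) false ≡ count neither + count (λ e → mixed e ∧ not (g e))
    size-projected-false g = trans (size-false G (projected g)) (count-split (λ e → indicator-not-resolve (L e) (R e) (g e)))

    touches-projected : ∀ g {b v} → TouchesColour G (projected g) b v →
      TouchesColour (split G) c′ b (orig v) ⊎ T (image (blame g) mixed v)
    touches-projected g (e , de≡b , incident) with resolve-endpoint (L e) (R e) (g e) de≡b incident
    ... | inj₁ (Le≡b , refl)        = inj₁ (left e , Le≡b , incident-left-end₁ e)
    ... | inj₂ (inj₁ (Re≡b , refl)) = inj₁ (right e , Re≡b , incident-right-end₂ e)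
    ... | inj₂ (inj₂ blamed)        = inj₂ (T-does⁺ (any? _) (e , blamed))

    bichromatic-projected : ∀ g v → T (bichromatic G (projected g) v) →
      T (bichromatic (split G) c′ (orig v)) ⊎ T (image (blame g) mixed v)
    bichromatic-projected g v bichr with bichromatic⁻ G (projected g) bichr
    ... | t , f with touches-projected g t | touches-projected g f
    ... | inj₁ t′ | inj₁ f′ = inj₁ (bichromatic⁺ (split G) c′ t′ f′)
    ... | inj₂ blamed | _   = inj₂ blamed
    ... | _ | inj₂ blamed   = inj₂ blamed

    mixed-bichromatic : ∀ e → T (mixed e) → T (bichromatic (split G) c′ (mid e))
    mixed-bichromatic e mixed-e with L e in Le≡ | R e in Re≡
    ... | true  | false = bichromatic⁺ (split G) c′ (left e , Le≡ , incident-left-mid e) (right e , Re≡ , incident-right-mid e)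
    ... | false | true  = bichromatic⁺ (split G) c′ (right e , Re≡ , incident-right-mid e) (left e , Le≡ , incident-left-mid e)

    cost-projected : ∀ g → cost G (projected g) ≤ cost (split G) c′
    cost-projected g = begin
      cost G (projected g)                           ≡⟨ cost-count G (projected g) ⟩
      count (bichromatic G (projected g))            ≤⟨ count-≤-+ (bichromatic-projected g) ⟩
      count (bichromatic (split G) c′ ∘ orig) + count (image (blame g) mixed)
        ≤⟨ +-monoʳ-≤ _ (≤-trans (count-image (blame g) mixed) (count-mono mixed-bichromatic)) ⟩
      count (bichromatic (split G) c′ ∘ orig) + count (bichromatic (split G) c′ ∘ mid)
        ≡⟨ count-vertices (bichromatic (split G) c′) ⟨
      count (bichromatic (split G) c′)               ≡⟨ cost-count (split G) c′ ⟨
      cost (split G) c′                              ∎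
      where open ≤-Reasoning

    project : ∀ {b} → Within (b + b) (split G) c′ → Σ[ d ∈ Partition G ] (Within b G d × cost G d ≤ cost (split G) c′)
    project {b} (true≤ , false≤)
      with split-budget (count both) (count neither) (count mixed) b
             (subst (_≤ b + b) size-split-true true≤) (subst (_≤ b + b) size-split-false false≤)
    ... | y , z , y+z≡mixed , both+y≤b , neither+z≤b
      with count-choose mixed y (subst (y ≤_) y+z≡mixed (m≤m+n y z))
    ... | g , chosen≡y = projected g , (true≤b , false≤b) , cost-projected g
      where
      unchosen≡z : count (λ e → mixed e ∧ not (g e)) ≡ z
      unchosen≡z = +-cancelˡ-≡ y _ z (begin
        y + count (λ e → mixed e ∧ not (g e))                                ≡⟨ cong (_+ _) chosen≡y ⟨
        count (λ e → mixed e ∧ g e) + count (λ e → mixed e ∧ not (g e))     ≡⟨ count-∧-not mixed g ⟨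
        count mixed                                                          ≡⟨ y+z≡mixed ⟨
        y + z                                                                ∎)
        where open ≡-Reasoning
      true≤b : size G (projected g) true ≤ b
      true≤b = subst (_≤ b) (sym (trans (size-projected-true g) (cong (count both +_) chosen≡y))) both+y≤b
      false≤b : size G (projected g) false ≤ b
      false≤b = subst (_≤ b) (sym (trans (size-projected-false g) (cong (count neither +_) unchosen≡z))) neither+z≤b

module Balance where

  open Partitions
  open import Data.Nat as ℕ using (ℕ; suc)
  import Data.Nat.Coprimality as Coprime
  open import Data.Integer as ℤ using (+_; -[1+_])
  import Data.Integer.Properties as ℤ
  open import Data.Rational
  open import Data.Rational.Properties

  capacity : ℚ → ℕ → ℚ
  capacity ε m = ((1ℚ + ε) * ℕ→ℚ m) * ½

  ℕ→ℚ-normal : ∀ k → ℕ→ℚ k ≡ mkℚ (+ k) 0 (Coprime.sym (Coprime.1-coprimeTo k))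
  ℕ→ℚ-normal k = normalize-coprime (Coprime.sym (Coprime.1-coprimeTo k))

  ℕ→ℚ-homo-+ : ∀ a b → ℕ→ℚ (a ℕ.+ b) ≡ ℕ→ℚ a + ℕ→ℚ b
  ℕ→ℚ-homo-+ a b rewrite ℕ→ℚ-normal a | ℕ→ℚ-normal b =
    sym (cong (_/ 1) (cong₂ ℤ._+_ (ℤ.*-identityʳ (+ a)) (ℤ.*-identityʳ (+ b))))

  ℕ→ℚ-mono-≤ : ∀ {a b} → a ℕ.≤ b → ℕ→ℚ a ≤ ℕ→ℚ b
  ℕ→ℚ-mono-≤ {a} {b} a≤b rewrite ℕ→ℚ-normal a | ℕ→ℚ-normal b =
    *≤* (subst₂ ℤ._≤_ (sym (ℤ.*-identityʳ (+ a))) (sym (ℤ.*-identityʳ (+ b))) (ℤ.+≤+ a≤b))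

  ℕ→ℚ-cancel-≤ : ∀ {a b} → ℕ→ℚ a ≤ ℕ→ℚ b → a ℕ.≤ b
  ℕ→ℚ-cancel-≤ {a} {b} a≤b rewrite ℕ→ℚ-normal a | ℕ→ℚ-normal b
    with drop-*≤* a≤b
  ... | a*1≤b*1 rewrite ℤ.*-identityʳ (+ a) | ℤ.*-identityʳ (+ b) = ℤ.drop‿+≤+ a*1≤b*1

  capacity-homo-+ : ∀ ε a b → capacity ε (a ℕ.+ b) ≡ capacity ε a + capacity ε b
  capacity-homo-+ ε a b = begin
    ((1ℚ + ε) * ℕ→ℚ (a ℕ.+ b)) * ½              ≡⟨ cong (λ q → ((1ℚ + ε) * q) * ½) (ℕ→ℚ-homo-+ a b) ⟩
    ((1ℚ + ε) * (ℕ→ℚ a + ℕ→ℚ b)) * ½            ≡⟨ cong (_* ½) (*-distribˡ-+ (1ℚ + ε) (ℕ→ℚ a) (ℕ→ℚ b)) ⟩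
    ((1ℚ + ε) * ℕ→ℚ a + (1ℚ + ε) * ℕ→ℚ b) * ½  ≡⟨ *-distribʳ-+ ½ ((1ℚ + ε) * ℕ→ℚ a) ((1ℚ + ε) * ℕ→ℚ b) ⟩
    capacity ε a + capacity ε b                 ∎
    where open ≡-Reasoning

  capacity-nonNeg : ∀ {ε} m → 0ℚ ≤ ε → 0ℚ ≤ capacity ε m
  capacity-nonNeg {ε} m 0≤ε = nonNegative⁻¹ (capacity ε m)
    where
    instance
      ε-nonNeg : NonNegative ε
      ε-nonNeg = nonNegative 0≤ε
      1+ε-nonNeg : NonNegative (1ℚ + ε)
      1+ε-nonNeg = nonNeg+nonNeg⇒nonNeg 1ℚ ε
      m-nonNeg : NonNegative (ℕ→ℚ m)
      m-nonNeg = subst NonNegative (sym (ℕ→ℚ-normal m)) _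
      [1+ε]m-nonNeg : NonNegative ((1ℚ + ε) * ℕ→ℚ m)
      [1+ε]m-nonNeg = nonNeg*nonNeg⇒nonNeg (1ℚ + ε) (ℕ→ℚ m)
      capacity-nonNeg′ : NonNegative (capacity ε m)
      capacity-nonNeg′ = nonNeg*nonNeg⇒nonNeg ((1ℚ + ε) * ℕ→ℚ m) ½

  0≰-[1+n]/1 : ∀ k → ¬ (0ℚ ≤ -[1+ k ] / 1)
  -- With `rewrite` in place of `subst` type checking this clause blows up.
  0≰-[1+n]/1 k 0≤-k with drop-*≤* (subst (0ℚ ≤_) (cong -_ (normalize-coprime {suc k} {0} (Coprime.sym (Coprime.1-coprimeTo (suc k))))) 0≤-k)
  ... | ()

  capacity-ℕ : ∀ {ε} m → 0ℚ ≤ ε → IsInteger (capacity ε m) → ∃[ b ] capacity ε m ≡ ℕ→ℚ b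
  capacity-ℕ m 0≤ε (+ b , eq) = b , eq
  capacity-ℕ m 0≤ε (-[1+ k ] , eq) = contradiction (subst (0ℚ ≤_) eq (capacity-nonNeg m 0≤ε)) (0≰-[1+n]/1 k)

  module _ (ε : ℚ) where

    Balanced⇔Within : ∀ G b c → capacity ε (m G) ≡ ℕ→ℚ b → Balanced ε G c ⇔ Within b G c
    Balanced⇔Within G b c capacity≡b = mk⇔
      (λ (true≤ , false≤) → ℕ→ℚ-cancel-≤ (subst (_ ≤_) capacity≡b true≤) , ℕ→ℚ-cancel-≤ (subst (_ ≤_) capacity≡b false≤))
      (λ (true≤ , false≤) → subst (_ ≤_) (sym capacity≡b) (ℕ→ℚ-mono-≤ true≤) , subst (_ ≤_) (sym capacity≡b) (ℕ→ℚ-mono-≤ false≤))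

    capacity-split : ∀ G b → capacity ε (m G) ≡ ℕ→ℚ b → capacity ε (m (split G)) ≡ ℕ→ℚ (b ℕ.+ b)
    capacity-split G b capacity≡b = begin
      capacity ε (m G ℕ.+ m G)              ≡⟨ capacity-homo-+ ε (m G) (m G) ⟩
      capacity ε (m G) + capacity ε (m G)   ≡⟨ cong₂ _+_ capacity≡b capacity≡b ⟩
      ℕ→ℚ b + ℕ→ℚ b                         ≡⟨ ℕ→ℚ-homo-+ b b ⟨
      ℕ→ℚ (b ℕ.+ b)                         ∎
      where open ≡-Reasoning

    dominatedBy-split : ∀ G b → capacity ε (m G) ≡ ℕ→ℚ b → DominatedBy ε G (split G)
    dominatedBy-split G b capacity≡b c balanced =
      let within = Equivalence.to (Balanced⇔Within G b c capacity≡b) balanced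
      in lifted , Equivalence.from (Balanced⇔Within (split G) (b ℕ.+ b) lifted (capacity-split G b capacity≡b)) (within-lifted within)
                , cost-lifted
      where open Subdivision.Lift G c

    split-dominatedBy : ∀ G b → capacity ε (m G) ≡ ℕ→ℚ b → DominatedBy ε (split G) G
    split-dominatedBy G b capacity≡b c′ balanced′ =
      let d , within , d≤c′ = Subdivision.Projection.project G c′
                                (Equivalence.to (Balanced⇔Within (split G) (b ℕ.+ b) c′ (capacity-split G b capacity≡b)) balanced′)
      in d , Equivalence.from (Balanced⇔Within G b d capacity≡b) within , d≤c′

open Partitions using (IsGEB-transfer)
open Balance using (capacity-ℕ; dominatedBy-split; split-dominatedBy)
open import Data.Nat using (ℕ)
open import Data.Rational using (ℚ; _*_; _+_; 0ℚ; 1ℚ; ½; _≤_; _<_)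

mainTheorem7 : (ε : ℚ) → 0ℚ ≤ ε → ε < 1ℚ →
    (G : Graph) → IsSimple G →
    IsInteger (ε * ℕ→ℚ (m G)) →
    IsInteger (((1ℚ + ε) * ℕ→ℚ (m G)) * ½) →
    (k : ℕ) → IsGEB ε G k ⇔ IsGEB ε (split G) k
mainTheorem7 ε 0≤ε _ G _ _ capacity-integral k =
  let b , capacity≡b = capacity-ℕ (m G) 0≤ε capacity-integral
      lift = dominatedBy-split ε G b capacity≡b
      project = split-dominatedBy ε G b capacity≡b
  in mk⇔ (IsGEB-transfer {ε} {G} {split G} lift project) (IsGEB-transfer {ε} {split G} {G} project lift)
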